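{- Let $n,m,c$ be positive integers such that $G_{n,m}$ is not $c$-colorable and $c\ge 9288$. Then any tree resolution proof that $GRID(n,m,c)$ is unsatisfiable has size at least $2^{Dc}$, where $D=0.836$.
   Context: $[x]=\{1,\ldots,x\}$, $G_{n,m}=[n]\times[m]$. A rectangle is a subset $\{(a,b),(a+c_1,b),(a+c_1,b+c_2),(a,b+c_2)\}\subseteq G_{n,m}$ with $a,b,c_1,c_2$ positive integers; $G_{n,m}$ is $c$-colorable if there is a map $G_{n,m}\to[c]$ with no rectangle having all four corners of the same color. $GRID(n,m,c)$ is the CNF formula with variables $x_{ijk}$ ($i\in[n]$, $j\in[m]$, $k\in[c]$) consisting of: for every $(i,j)$ the clause $\bigvee_{k=1}^c x_{ijk}$; and for all $1\le i<i'\le n$, $1\le j<j'\le m$ and every $k\in[c]$ the clause $\neg x_{ijk}\vee\neg x_{i'jk}\vee\neg x_{ij'k}\vee\neg x_{i'j'k}$. It is satisfiable iff $G_{n,m}$ is $c$-colorable. A resolution proof of unsatisfiability of a CNF $\varphi$ is a sequence of clauses, each either a clause of $\varphi$ or obtained as $A\vee B$ from earlier clauses $A\vee x$ and $B\vee\neg x$, ending with the empty clause; it is a tree resolution proof if its underlying derivation graph is a tree; size is the number of clauses. -}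

module Defs where

open import Data.Nat using (ℕ; zero; suc)
open import Data.Fin using (Fin; _<_)
open import Data.Product using (_×_; Σ; ∃; _,_)
open import Data.Sum using (_⊎_)
open import Data.List using (List; []; _∷_)
open import Data.List.Membership.Propositional using (_∈_)
open import Data.Vec.Functional using () renaming (toList to vtoList)
open import Data.List using (tabulate)
open import Relation.Binary.PropositionalEquality using (_≡_; _≢_)
open import Relation.Nullary using (¬_)
open import Function.Bundles using (_⇔_)

Colorable : ℕ → ℕ → ℕ → Set
Colorable n m c =
  Σ (Fin n → Fin m → Fin c) λ χ →
    ∀ (a a' : Fin n) (b b' : Fin m) → a < a' → b < b' →
      ¬ (χ a b ≡ χ a' b × χ a b ≡ χ a b' × χ a b ≡ χ a' b')

data Lit (V : Set) : Set where
  pos : V → Lit V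
  neg : V → Lit V

-- A clause is a (finite) set of literals, represented by a list;
-- only membership matters (see the resolution rule below).
Clause : Set → Set
Clause V = List (Lit V)

CNF : Set → Set₁
CNF V = Clause V → Set

-- Tree resolution proofs: a derivation tree whose leaves are clauses
-- of φ and whose inner nodes apply the resolution rule
--   from  A ∨ x  and  B ∨ ¬x  infer  A ∨ B
-- (with clauses read as sets of literals).
data TreeRes {V : Set} (φ : CNF V) : Clause V → Set where
  axiom   : ∀ {C} → φ C → TreeRes φ C
  resolve : ∀ {C₁ C₂ D} (x : V) →
            TreeRes φ C₁ → TreeRes φ C₂ →
            pos x ∈ C₁ → neg x ∈ C₂ →
            (∀ l → l ∈ D ⇔ ((l ∈ C₁ × l ≢ pos x) ⊎ (l ∈ C₂ × l ≢ neg x))) →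
            TreeRes φ D

size : ∀ {V} {φ : CNF V} {C} → TreeRes φ C → ℕ
size (axiom _) = 1
size (resolve _ p q _ _ _) = suc (size p Data.Nat.+ size q)

TreeRefutation : ∀ {V} → CNF V → Set
TreeRefutation φ = TreeRes φ []

GVar : ℕ → ℕ → ℕ → Set
GVar n m c = Fin n × Fin m × Fin c

data GRID (n m c : ℕ) : CNF (GVar n m c) where
  someColor : (i : Fin n) (j : Fin m) →
              GRID n m c (tabulate (λ (k : Fin c) → pos (i , j , k)))
  noRect : (i i' : Fin n) (j j' : Fin m) (k : Fin c) → i < i' → j < j' →
           GRID n m c ( neg (i , j , k) ∷ neg (i' , j , k)
                      ∷ neg (i , j' , k) ∷ neg (i' , j' , k) ∷ [])

module Submission where

-- A tree resolution refutation of GRID(n,m,c) has at least 2^c clauses,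
-- which is stronger than the bound 2^(0.836 c) of the theorem.
--
-- The argument is a Prover–Delayer game (Pudlák–Impagliazzo).  Read a tree
-- proof top-down: starting at the empty clause, each resolution step on a
-- variable x queries x, and we descend into the premise that the current
-- partial assignment falsifies.  If a Delayer can keep a potential μ that
-- drops by at most one per query, doubling the subtree whenever both answers
-- are still open, and no axiom is ever falsified while μ > 0, then the tree
-- has at least 2^μ nodes.
--
-- For GRID(n,m,c) the Delayer records, for each colour k, either nothing, or
-- "colour k is unused", or "colour k is used exactly at point (i,j)"; the
-- potential is the number of undecided colours.  Every colour is then used
-- at most once, so no rectangle clause is falsified, and a point clause can
-- only be falsified once all c colours are decided.  Starting from the empty
-- record gives 2^c ≤ size, and the theorem follows by raising to powers.

open import Defs
open import Data.Nat using (ℕ; _≤_; _*_; _^_)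
open import Relation.Nullary using (¬_)

open import Data.Nat using (zero; suc; _+_; s≤s; NonZero)
open import Data.Nat.Properties
  using (≤-refl; ≤-reflexive; ≤-trans; m≤m+n; m≤n+m; n≤1+n; +-mono-≤; +-suc; +-identityʳ;
         *-comm; m^n>0; ^-monoʳ-≤; ^-monoˡ-≤; ^-*-assoc)
open import Data.Bool using (Bool; true; false; _∧_)
open import Data.Bool.Properties using () renaming (_≟_ to _≟ᵇ_)
open import Data.Maybe using (Maybe; just; nothing; map)
open import Data.Maybe.Properties using (just-injective) renaming (≡-dec to ≡-decᵐ)
open import Data.Fin using (Fin; _<_) renaming (zero to fzero; suc to fsuc; _≟_ to _≟ᶠ_)
open import Data.Fin.Properties using (<-irrefl)
open import Data.Vec.Functional using (Vector; updateAt)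
open import Data.Vec.Functional.Properties using (updateAt-updates; updateAt-minimal)
open import Data.Product using (_×_; ∃; _,_)
open import Data.Sum using (_⊎_; inj₁; inj₂)
open import Data.Empty using (⊥-elim)
open import Data.List.Membership.Propositional using (_∈_)
open import Data.List.Membership.Propositional.Properties using (∈-tabulate⁺)
open import Data.List.Relation.Unary.Any using (here; there)
open import Relation.Nullary using (yes; no; does; Dec)
open import Relation.Binary.PropositionalEquality using (_≡_; _≢_; refl; sym; trans; cong; subst)
open import Function.Bundles using (_⇔_; Equivalence)

module PartialAssignment {V : Set} where

  Assignment : Set
  Assignment = V → Maybe Bool

  _⊭_ : Assignment → Lit V → Set
  ρ ⊭ pos x = ρ x ≡ just false
  ρ ⊭ neg x = ρ x ≡ just true

  _⊭?_ : ∀ ρ l → Dec (ρ ⊭ l)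
  ρ ⊭? pos x = ≡-decᵐ _≟ᵇ_ (ρ x) (just false)
  ρ ⊭? neg x = ≡-decᵐ _≟ᵇ_ (ρ x) (just true)

  Falsifies : Assignment → Clause V → Set
  Falsifies ρ C = ∀ l → l ∈ C → ρ ⊭ l

  _⊑_ : Assignment → Assignment → Set
  ρ ⊑ ρ′ = ∀ x b → ρ x ≡ just b → ρ′ x ≡ just b

  ⊑-refl : ∀ {ρ} → ρ ⊑ ρ
  ⊑-refl x b e = e

  ⊭-mono : ∀ {ρ ρ′} → ρ ⊑ ρ′ → ∀ l → ρ ⊭ l → ρ′ ⊭ l
  ⊭-mono ext (pos x) = ext x false
  ⊭-mono ext (neg x) = ext x true

  -- Deciding whether ρ′ falsifies a literal avoids
  -- needing decidable equality on variables.
  premise-falsified : ∀ {ρ ρ′ C D} lx → ρ ⊑ ρ′ → ρ′ ⊭ lx → Falsifies ρ D →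
                      (∀ l → l ∈ C → l ≢ lx → l ∈ D) → Falsifies ρ′ C
  premise-falsified {ρ′ = ρ′} lx ext ρ′⊭lx ρ⊭D C⊆D l l∈C with ρ′ ⊭? l
  ... | yes ρ′⊭l = ρ′⊭l
  ... | no ρ′⊨l = ⊭-mono ext l (ρ⊭D l (C⊆D l l∈C λ { refl → ρ′⊨l ρ′⊭lx }))

  Resolvent : V → Clause V → Clause V → Clause V → Set
  Resolvent x C₁ C₂ D = ∀ l → l ∈ D ⇔ ((l ∈ C₁ × l ≢ pos x) ⊎ (l ∈ C₂ × l ≢ neg x))

  resolvent-left : ∀ {x C₁ C₂ D} → Resolvent x C₁ C₂ D → ∀ l → l ∈ C₁ → l ≢ pos x → l ∈ D
  resolvent-left D⇔ l l∈ l≢ = Equivalence.from (D⇔ l) (inj₁ (l∈ , l≢))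

  resolvent-right : ∀ {x C₁ C₂ D} → Resolvent x C₁ C₂ D → ∀ l → l ∈ C₂ → l ≢ neg x → l ∈ D
  resolvent-right D⇔ l l∈ l≢ = Equivalence.from (D⇔ l) (inj₂ (l∈ , l≢))

m≤1+m+n : ∀ a b → a ≤ suc (a + b)
m≤1+m+n a b = ≤-trans (m≤m+n a b) (n≤1+n _)

n≤1+m+n : ∀ a b → b ≤ suc (a + b)
n≤1+m+n a b = ≤-trans (m≤n+m b a) (n≤1+n _)

2^-split : ∀ {k a b} → k ≤ suc a → k ≤ suc b → 2 ^ k ≤ 2 ^ a + 2 ^ b
2^-split {zero} {a} _ _ = ≤-trans (m^n>0 2 a) (m≤m+n _ _)
2^-split {suc k} (s≤s k≤a) (s≤s k≤b) =
  +-mono-≤ (^-monoʳ-≤ 2 k≤a) (≤-trans (≤-reflexive (+-identityʳ _)) (^-monoʳ-≤ 2 k≤b))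

-- A Delayer strategy for φ: states s with an assignment ⟦ s ⟧ and a
-- potential μ s.
module DelayerBound {V : Set} (φ : CNF V) {S : Set}
                    (⟦_⟧ : S → V → Maybe Bool) (μ : S → ℕ) where

  open PartialAssignment {V}

  Answer : S → V → Bool → Set
  Answer s x b = ∃ λ s′ → ⟦ s ⟧ ⊑ ⟦ s′ ⟧ × ⟦ s′ ⟧ x ≡ just b × μ s ≤ suc (μ s′)

  module _ (axiom-safe : ∀ {s C} → φ C → Falsifies ⟦ s ⟧ C → μ s ≡ 0)
           (query : ∀ s x → (∃ λ b → ⟦ s ⟧ x ≡ just b) ⊎ (∀ b → Answer s x b)) where

    lower-bound : ∀ {D} (p : TreeRes φ D) s → Falsifies ⟦ s ⟧ D → 2 ^ μ s ≤ size p

    descend : ∀ {C D s s′} lx (p : TreeRes φ C) → Falsifies ⟦ s ⟧ D →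
              ⟦ s ⟧ ⊑ ⟦ s′ ⟧ → ⟦ s′ ⟧ ⊭ lx → (∀ l → l ∈ C → l ≢ lx → l ∈ D) →
              2 ^ μ s′ ≤ size p
    descend {s′ = s′} lx p ⊭D ext ⊭lx C⊆D = lower-bound p s′ (premise-falsified lx ext ⊭lx ⊭D C⊆D)

    lower-bound (axiom φC) s ⊭D rewrite axiom-safe φC ⊭D = ≤-refl
    lower-bound (resolve x p q _ _ D⇔) s ⊭D with query s x
    ... | inj₁ (false , x≡0) =
      ≤-trans (descend (pos x) p ⊭D ⊑-refl x≡0 (resolvent-left D⇔)) (m≤1+m+n (size p) (size q))
    ... | inj₁ (true , x≡1) =
      ≤-trans (descend (neg x) q ⊭D ⊑-refl x≡1 (resolvent-right D⇔)) (n≤1+m+n (size p) (size q))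
    ... | inj₂ answer with answer false | answer true
    ... | s₀ , ext₀ , x≡0 , μ₀ | s₁ , ext₁ , x≡1 , μ₁ =
      ≤-trans (2^-split μ₀ μ₁)
        (≤-trans (+-mono-≤ (descend (pos x) p ⊭D ext₀ x≡0 (resolvent-left D⇔))
                           (descend (neg x) q ⊭D ext₁ x≡1 (resolvent-right D⇔)))
                 (n≤1+n _))

nothing≢just : ∀ {A : Set} {a : A} → nothing ≢ just a
nothing≢just ()

isUndecided : ∀ {A : Set} → Maybe A → ℕ
isUndecided nothing = 1
isUndecided (just _) = 0

undecided : ∀ {A : Set} {c} → Vector (Maybe A) c → ℕ
undecided {c = zero} σ = 0
undecided {c = suc c} σ = isUndecided (σ fzero) + undecided (λ k → σ (fsuc k))

undecided-empty : ∀ {A : Set} c → undecided {A} {c} (λ _ → nothing) ≡ c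
undecided-empty zero = refl
undecided-empty (suc c) = cong suc (undecided-empty c)

undecided-full : ∀ {A : Set} {c} (σ : Vector (Maybe A) c) → (∀ k → σ k ≢ nothing) → undecided σ ≡ 0
undecided-full {c = zero} σ decided = refl
undecided-full {c = suc c} σ decided with σ fzero in σ₀
... | nothing = ⊥-elim (decided fzero σ₀)
... | just _ = undecided-full (λ k → σ (fsuc k)) (λ k → decided (fsuc k))

undecided-decide : ∀ {A : Set} {c} (σ : Vector (Maybe A) c) k (a : A) → σ k ≡ nothing →
                   undecided σ ≡ suc (undecided (updateAt σ k (λ _ → just a)))
undecided-decide {c = suc c} σ fzero a σk rewrite σk = refl
undecided-decide {c = suc c} σ (fsuc k) a σk =
  trans (cong (isUndecided (σ fzero) +_) (undecided-decide (λ k′ → σ (fsuc k′)) k a σk))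
        (+-suc (isUndecided (σ fzero)) _)

module GridDelayer {n m c : ℕ} where

  open PartialAssignment {GVar n m c}

  data Usage : Set where
    unused : Usage
    usedAt : Fin n → Fin m → Usage

  State : Set
  State = Vector (Maybe Usage) c

  colours : Fin n → Fin m → Usage → Bool
  colours i j unused = false
  colours i j (usedAt a b) = does (i ≟ᶠ a) ∧ does (j ≟ᶠ b)

  colours-self : ∀ i j → colours i j (usedAt i j) ≡ true
  colours-self i j with i ≟ᶠ i | j ≟ᶠ j
  ... | yes _ | yes _ = refl
  ... | yes _ | no j≢j = ⊥-elim (j≢j refl)
  ... | no i≢i | _ = ⊥-elim (i≢i refl)

  colours-unique : ∀ i j u → colours i j u ≡ true → u ≡ usedAt i j
  colours-unique i j unused ()
  colours-unique i j (usedAt a b) eq with i ≟ᶠ a | j ≟ᶠ b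
  colours-unique i j (usedAt i j) eq | yes refl | yes refl = refl
  colours-unique i j (usedAt a b) () | yes _ | no _
  colours-unique i j (usedAt a b) () | no _ | _

  ⟦_⟧ : State → Assignment
  ⟦ σ ⟧ (i , j , k) = map (colours i j) (σ k)

  choose : Fin n → Fin m → Bool → Usage
  choose i j false = unused
  choose i j true = usedAt i j

  choose-value : ∀ i j b → colours i j (choose i j b) ≡ b
  choose-value i j false = refl
  choose-value i j true = colours-self i j

  decide-extends : ∀ σ k u → σ k ≡ nothing → ⟦ σ ⟧ ⊑ ⟦ updateAt σ k (λ _ → just u) ⟧
  decide-extends σ k u σk (i , j , k′) b eq with k′ ≟ᶠ k
  ... | yes refl rewrite σk = ⊥-elim (nothing≢just eq)
  ... | no k′≢k = trans (cong (map (colours i j)) (updateAt-minimal k′ k σ k′≢k)) eq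

  query : ∀ σ x → (∃ λ b → ⟦ σ ⟧ x ≡ just b) ⊎
                    (∀ b → DelayerBound.Answer (GRID n m c) ⟦_⟧ undecided σ x b)
  query σ (i , j , k) with σ k in σk
  ... | just u = inj₁ (colours i j u , refl)
  ... | nothing = inj₂ λ b →
    let u = choose i j b in
    updateAt σ k (λ _ → just u) ,
    decide-extends σ k u σk ,
    trans (cong (map (colours i j)) (updateAt-updates k σ)) (cong just (choose-value i j b)) ,
    ≤-reflexive (undecided-decide σ k u σk)

  -- No axiom is falsified while a colour is undecided: a falsified point
  -- clause decides every colour, and a falsified rectangle clause would use
  -- one colour at two distinct points.
  axiom-safe : ∀ {σ C} → GRID n m c C → Falsifies ⟦ σ ⟧ C → undecided σ ≡ 0
  axiom-safe {σ} (someColor i j) ⊭C = undecided-full σ λ k σk →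
    nothing≢just (trans (sym (cong (map (colours i j)) σk)) (⊭C (pos (i , j , k)) (∈-tabulate⁺ k)))
  axiom-safe {σ} (noRect i i′ j j′ k i<i′ _) ⊭C = ⊥-elim (<-irrefl i≡i′ i<i′)
    where
    usage-at : ∀ a → map (colours a j) (σ k) ≡ just true → σ k ≡ just (usedAt a j)
    usage-at a eq with σ k
    ... | just u = cong just (colours-unique a j u (just-injective eq))
    i≡i′ : i ≡ i′
    i≡i′ with trans (sym (usage-at i (⊭C _ (here refl)))) (usage-at i′ (⊭C _ (there (here refl))))
    ... | refl = refl

  open DelayerBound (GRID n m c) ⟦_⟧ undecided using (lower-bound)

  refutation-size : (p : TreeRefutation (GRID n m c)) → 2 ^ c ≤ size p
  refutation-size p = subst (_≤ size p) (cong (2 ^_) (undecided-empty c))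
    (lower-bound axiom-safe query p (λ _ → nothing) (λ _ ()))

size-nonZero : ∀ {V} {φ : CNF V} {C} (p : TreeRes φ C) → NonZero (size p)
size-nonZero (axiom _) = _
size-nonZero (resolve _ _ _ _ _ _) = _

theorem5p5 : (n m c : ℕ) → 1 ≤ n → 1 ≤ m → 1 ≤ c →
    ¬ Colorable n m c → 9288 ≤ c →
    (p : TreeRefutation (GRID n m c)) →
    2 ^ (836 * c) ≤ size p ^ 1000
theorem5p5 n m c _ _ _ _ _ p = begin
  2 ^ (836 * c)   ≡⟨ cong (2 ^_) (*-comm 836 c) ⟩
  2 ^ (c * 836)   ≡⟨ sym (^-*-assoc 2 c 836) ⟩
  (2 ^ c) ^ 836   ≤⟨ ^-monoˡ-≤ 836 (GridDelayer.refutation-size p) ⟩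
  size p ^ 836    ≤⟨ ^-monoʳ-≤ (size p) {{size-nonZero p}} (m≤m+n 836 164) ⟩
  size p ^ 1000   ∎
  where open Data.Nat.Properties.≤-Reasoning
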